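{- Let $p\ge 2$ and $q\ge 2$ be integers, let $g_1,\dots,g_p$ and $h_1,\dots,h_q$ be fixed symbols, and let $K$ be a graph with vertex set $\{(g_i,h_j)\mid 1\le i\le p,\ 1\le j\le q\}$. The following statements are equivalent: (i) $K\in\mathcal{K}(p,q)$; (ii) $K$ is a spanning, cross-like subgraph of $K_p\otimes K_q$ (where $K_p$ and $K_q$ are the complete graphs on $\{g_1,\dots,g_p\}$ and $\{h_1,\dots,h_q\}$); (iii) $K$ is a 2-sum of tensor-elementary graphs $E(i,i';j,j')$.
   Context: All graphs are finite, simple (no loops, no multiple edges). A graph is nontrivial if it has at least one edge. The tensor product $G\otimes H$ of graphs $G,H$ has vertex set $V(G)\times V(H)$, and $\{(g,h),(g',h')\}$ is an edge iff $\{g,g'\}\in E(G)$ and $\{h,h'\}\in E(H)$. For graphs $G,H$ on the same vertex set, the 2-sum $G\oplus H$ is the graph on that vertex set whose edges are those lying in exactly one of $E(G)$, $E(H)$ (addition of adjacency matrices modulo 2). $\mathcal{K}(p,q)$ denotes the set of graphs $K$ on vertex set $\{(g_i,h_j)\}$ for which there exist a positive integer $l$, nontrivial graphs $G_1,\dots,G_l$ on vertex set $\{g_1,\dots,g_p\}$ and nontrivial graphs $H_1,\dots,H_l$ on vertex set $\{h_1,\dots,h_q\}$ with $K=\bigoplus_{k=1}^{l}(G_k\otimes H_k)$. A spanning subgraph $K$ of $G\otimes H$ is cross-like if whenever $\{(g_i,h_j),(g_{i'},h_{j'})\}\in E(K)$, also $\{(g_i,h_{j'}),(g_{i'},h_j)\}\in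 E(K)$. For $i\ne i'$ and $j\ne j'$, the tensor-elementary graph $E(i,i';j,j')$ is $G\otimes H$ where $G$ is the graph on $\{g_1,\dots,g_p\}$ with single edge $\{g_i,g_{i'}\}$ and $H$ is the graph on $\{h_1,\dots,h_q\}$ with single edge $\{h_j,h_{j'}\}$. -}

module Defs where

open import Data.Bool using (Bool; true; false; _∧_; _∨_; _xor_)
open import Data.Bool.Properties using (∧-comm; ∨-comm)
open import Data.Nat using (ℕ)
open import Data.Fin using (Fin; _≟_)
open import Data.Product using (_×_; _,_; ∃-syntax)
open import Data.List using (foldr)
open import Data.List.NonEmpty using (List⁺; toList; map)
open import Data.Empty using (⊥-elim)
open import Relation.Nullary using (¬_; yes; no)
open import Relation.Nullary.Decidable using (⌊_⌋)
open import Relation.Binary.PropositionalEquality as Eq using (_≡_; refl; cong₂; trans)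

record Graph (V : Set) : Set where
  field
    adj    : V → V → Bool
    sym    : ∀ u v → adj u v ≡ adj v u
    irrefl : ∀ v → adj v v ≡ false
open Graph public

_≈G_ : ∀ {V} → Graph V → Graph V → Set
G ≈G H = ∀ u v → adj G u v ≡ adj H u v

Nontrivial : ∀ {V} → Graph V → Set
Nontrivial G = ∃[ u ] ∃[ v ] (adj G u v ≡ true)

-- Tensor product. Vertex g_i is (i : Fin p), h_j is (j : Fin q), (g_i,h_j) is (i , j).
_⊗_ : ∀ {A B} → Graph A → Graph B → Graph (A × B)
adj (G ⊗ H) (g , h) (g' , h') = adj G g g' ∧ adj H h h'
sym (G ⊗ H) (g , h) (g' , h') = cong₂ _∧_ (sym G g g') (sym H h h')
irrefl (G ⊗ H) (g , h) rewrite irrefl G g = refl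

-- 2-sum: symmetric difference of edge sets (adjacency matrices mod 2).
_⊕_ : ∀ {V} → Graph V → Graph V → Graph V
adj (G ⊕ H) u v = adj G u v xor adj H u v
sym (G ⊕ H) u v = cong₂ _xor_ (sym G u v) (sym H u v)
irrefl (G ⊕ H) v rewrite irrefl G v | irrefl H v = refl

emptyG : ∀ {V} → Graph V
adj emptyG _ _ = false
sym emptyG _ _ = refl
irrefl emptyG _ = refl

⨁ : ∀ {V} → List⁺ (Graph V) → Graph V
⨁ xs = foldr _⊕_ emptyG (toList xs)

completeG : (n : ℕ) → Graph (Fin n)
adj (completeG n) u v with u ≟ v
... | yes _ = false
... | no _ = true
sym (completeG n) u v with u ≟ v | v ≟ u
... | yes _ | yes _ = refl
... | no _  | no _  = refl
... | yes e | no ne = ⊥-elim (ne (Eq.sym e))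
... | no ne | yes e = ⊥-elim (ne (Eq.sym e))
irrefl (completeG n) v with v ≟ v
... | yes _ = refl
... | no ne = ⊥-elim (ne refl)

edgeG : ∀ {n} (a b : Fin n) → ¬ a ≡ b → Graph (Fin n)
adj (edgeG a b _) u v = (⌊ u ≟ a ⌋ ∧ ⌊ v ≟ b ⌋) ∨ (⌊ u ≟ b ⌋ ∧ ⌊ v ≟ a ⌋)
sym (edgeG a b _) u v =
  trans (∨-comm (⌊ u ≟ a ⌋ ∧ ⌊ v ≟ b ⌋) (⌊ u ≟ b ⌋ ∧ ⌊ v ≟ a ⌋))
        (cong₂ _∨_ (∧-comm ⌊ u ≟ b ⌋ ⌊ v ≟ a ⌋) (∧-comm ⌊ u ≟ a ⌋ ⌊ v ≟ b ⌋))
irrefl (edgeG a b a≢b) v with v ≟ a | v ≟ b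
... | yes e | yes e' = ⊥-elim (a≢b (trans (Eq.sym e) e'))
... | yes _ | no _ = refl
... | no _  | yes _ = refl
... | no _  | no _ = refl

record TensorTerm (p q : ℕ) : Set where
  field
    G  : Graph (Fin p)
    H  : Graph (Fin q)
    G-nontrivial : Nontrivial G
    H-nontrivial : Nontrivial H

termGraph : ∀ {p q} → TensorTerm p q → Graph (Fin p × Fin q)
termGraph t = TensorTerm.G t ⊗ TensorTerm.H t

InK : (p q : ℕ) → Graph (Fin p × Fin q) → Set
InK p q K = ∃[ ts ] (K ≈G ⨁ (map (termGraph {p} {q}) ts))

SpanningSubgraphOf : ∀ {V} → Graph V → Graph V → Set
SpanningSubgraphOf K L = ∀ u v → adj K u v ≡ true → adj L u v ≡ true

CrossLike : ∀ {p q} → Graph (Fin p × Fin q) → Set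
CrossLike K = ∀ i j i' j' → adj K (i , j) (i' , j') ≡ true → adj K (i , j') (i' , j) ≡ true

record ElemIndex (p q : ℕ) : Set where
  field
    i i' : Fin p
    j j' : Fin q
    i≢i' : ¬ i ≡ i'
    j≢j' : ¬ j ≡ j'

E : ∀ {p q} → ElemIndex p q → Graph (Fin p × Fin q)
E e = edgeG (ElemIndex.i e) (ElemIndex.i' e) (ElemIndex.i≢i' e)
    ⊗ edgeG (ElemIndex.j e) (ElemIndex.j' e) (ElemIndex.j≢j' e)

SumOfElementary : (p q : ℕ) → Graph (Fin p × Fin q) → Set
SumOfElementary p q K = ∃[ es ] (K ≈G ⨁ (map (E {p} {q}) es))

module Submission where

-- Call a graph K on A × B tensor-shaped if it has no edge inside a row {i} × B,
-- none inside a column A × {j}, and adj K (i,j) (i',j') = adj K (i,j') (i',j).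
-- For A = Fin p, B = Fin q this is exactly (ii): spanning in K_p ⊗ K_q and
-- cross-like.  Every tensor product G ⊗ H is tensor-shaped and the property is
-- closed under 2-sums, which gives (i) ⇒ (ii).  Conversely a tensor-shaped K is
-- the 2-sum of the elementary graphs E(i,i';j,j') over those rectangles
-- {i,i'} × {j,j'} (each listed once) whose diagonal (i,j)—(i',j') is an edge
-- of K, giving (ii) ⇒ (iii).
-- The computation behind this reduces, twice, to the fact that every graph on
-- Fin n is the 2-sum of its single-edge subgraphs (edge-decomposition), applied
-- to the slices of K obtained by fixing two rows or two columns.  Finally each
-- E(i,i';j,j') is a tensor product of two nontrivial graphs, so (iii) ⇒ (i).
-- Both (i) and (iii) ask for at least one summand, so the decomposition is
-- padded by E ⊕ E = ∅ for some elementary E; this is where p, q ≥ 2 is used.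

open import Defs
open import Data.Nat using (ℕ; zero; suc; _≥_; s≤s)
open import Data.Fin using (Fin; zero; suc; _≟_)
open import Data.Fin.Properties using (suc-injective)
open import Data.Product using (_×_; _,_)
open import Data.Bool using (Bool; true; false; _∧_; _∨_; _xor_; if_then_else_)
open import Data.Bool.Properties
  using (∧-comm; ∧-assoc; ∧-zeroʳ; ∨-identityʳ; xor-assoc; xor-same; xor-identityʳ;
         ¬-not; not-¬; ⇔→≡)
open import Data.List as List using (List; []; _∷_; _++_; [_]; concatMap; allFin)
open import Data.List.Properties using (map-tabulate; map-∘)
open import Data.List.NonEmpty as List⁺ using (_∷_)
open import Function using (_∘_; id)
open import Function.Bundles using (_⇔_; mk⇔)
open import Data.Empty using (⊥-elim)
open import Relation.Nullary using (yes; no)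
open import Relation.Nullary.Decidable using (⌊_⌋; isYes≗does; dec-true)
open import Relation.Binary.PropositionalEquality
  using (_≡_; _≢_; refl; trans; cong; cong₂; module ≡-Reasoning)
  renaming (sym to ≡-sym)

open ≡-Reasoning

xorSum : ∀ {A : Set} → List A → (A → Bool) → Bool
xorSum []       g = false
xorSum (x ∷ xs) g = g x xor xorSum xs g

module _ {A : Set} where

  xorSum-cong : ∀ (xs : List A) {g h : A → Bool} → (∀ x → g x ≡ h x) → xorSum xs g ≡ xorSum xs h
  xorSum-cong []       g≗h = refl
  xorSum-cong (x ∷ xs) g≗h = cong₂ _xor_ (g≗h x) (xorSum-cong xs g≗h)

  xorSum-zero : ∀ (xs : List A) {g : A → Bool} → (∀ x → g x ≡ false) → xorSum xs g ≡ false
  xorSum-zero []       g≗0 = refl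
  xorSum-zero (x ∷ xs) g≗0 = cong₂ _xor_ (g≗0 x) (xorSum-zero xs g≗0)

  xorSum-++ : ∀ (xs ys : List A) (g : A → Bool) → xorSum (xs ++ ys) g ≡ xorSum xs g xor xorSum ys g
  xorSum-++ []       ys g = refl
  xorSum-++ (x ∷ xs) ys g =
    trans (cong (g x xor_) (xorSum-++ xs ys g)) (≡-sym (xor-assoc (g x) (xorSum xs g) (xorSum ys g)))

  xorSum-map : ∀ {B : Set} (f : B → A) (xs : List B) (g : A → Bool) →
    xorSum (List.map f xs) g ≡ xorSum xs (g ∘ f)
  xorSum-map f []       g = refl
  xorSum-map f (x ∷ xs) g = cong (g (f x) xor_) (xorSum-map f xs g)

  xorSum-concatMap : ∀ {B : Set} (f : B → List A) (xs : List B) (g : A → Bool) →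
    xorSum (concatMap f xs) g ≡ xorSum xs (λ x → xorSum (f x) g)
  xorSum-concatMap f []       g = refl
  xorSum-concatMap f (x ∷ xs) g =
    trans (xorSum-++ (f x) (concatMap f xs) g) (cong (xorSum (f x) g xor_) (xorSum-concatMap f xs g))

  ∧-distrib-xorSum : ∀ b (xs : List A) (g : A → Bool) →
    b ∧ xorSum xs g ≡ xorSum xs (λ x → b ∧ g x)
  ∧-distrib-xorSum true  xs g = refl
  ∧-distrib-xorSum false xs g = ≡-sym (xorSum-zero xs (λ _ → refl))

  xorSum-if : ∀ b (x : A) (g : A → Bool) → xorSum (if b then [ x ] else []) g ≡ b ∧ g x
  xorSum-if true  x g = xor-identityʳ (g x)
  xorSum-if false x g = refl

≟-refl : ∀ {n} (a : Fin n) → ⌊ a ≟ a ⌋ ≡ true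
≟-refl a = trans (isYes≗does (a ≟ a)) (dec-true (a ≟ a) refl)

≟-suc : ∀ {n} (a b : Fin n) → ⌊ suc a ≟ suc b ⌋ ≡ ⌊ a ≟ b ⌋
≟-suc a b = trans (isYes≗does (suc a ≟ suc b)) (≡-sym (isYes≗does (a ≟ b)))

allFin-suc : ∀ n → allFin (suc n) ≡ zero ∷ List.map suc (allFin n)
allFin-suc n = cong (zero ∷_) (≡-sym (map-tabulate id suc))

xorSum-delta : ∀ {n} (a : Fin n) (f : Fin n → Bool) →
  xorSum (allFin n) (λ j → ⌊ a ≟ j ⌋ ∧ f j) ≡ f a
xorSum-delta {suc n} a f = begin
  xorSum (allFin (suc n)) δf
    ≡⟨ cong (λ xs → xorSum xs δf) (allFin-suc n) ⟩
  δf zero xor xorSum (List.map suc (allFin n)) δf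
    ≡⟨ cong (δf zero xor_) (xorSum-map suc (allFin n) δf) ⟩
  δf zero xor xorSum (allFin n) (δf ∘ suc)
    ≡⟨ split a ⟩
  f a ∎
  where
  δf : Fin (suc n) → Bool
  δf j = ⌊ a ≟ j ⌋ ∧ f j

  split : ∀ b → (⌊ b ≟ zero ⌋ ∧ f zero) xor xorSum (allFin n) (λ j → ⌊ b ≟ suc j ⌋ ∧ f (suc j))
                ≡ f b
  split zero    = trans (cong (f zero xor_) (xorSum-zero (allFin n) (λ _ → refl))) (xor-identityʳ (f zero))
  split (suc b) = trans (xorSum-cong (allFin n) (λ j → cong (_∧ f (suc j)) (≟-suc b j)))
                        (xorSum-delta b (f ∘ suc))

record Pair (n : ℕ) : Set where
  constructor pair
  field
    lo hi : Fin n
    lo≢hi : lo ≢ hi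
open Pair

edgeOf : ∀ {n} → Pair n → Graph (Fin n)
edgeOf P = edgeG (lo P) (hi P) (lo≢hi P)

fromZero : ∀ {n} → Fin n → Pair (suc n)
fromZero j = pair zero (suc j) (λ ())

shiftPair : ∀ {n} → Pair n → Pair (suc n)
shiftPair (pair i i' i≢i') = pair (suc i) (suc i') (i≢i' ∘ suc-injective)

pairs : ∀ n → List (Pair n)
pairs zero    = []
pairs (suc n) = List.map fromZero (allFin n) ++ List.map shiftPair (pairs n)

edgeTerm : ∀ {n} → Graph (Fin n) → Fin n → Fin n → Pair n → Bool
edgeTerm G a c P = adj (edgeOf P) a c ∧ adj G (lo P) (hi P)

edgeTerm-cong : ∀ {n} (G : Graph (Fin n)) a c (P : Pair n) {x} →
  adj (edgeOf P) a c ≡ x → edgeTerm G a c P ≡ x ∧ adj G (lo P) (hi P)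
edgeTerm-cong G a c P = cong (_∧ adj G (lo P) (hi P))

fromZero-sum : ∀ {n} (G : Graph (Fin (suc n))) v →
  xorSum (allFin n) (edgeTerm G zero (suc v) ∘ fromZero) ≡ adj G zero (suc v)
fromZero-sum {n} G v =
  trans (xorSum-cong (allFin n) (λ j → edgeTerm-cong G zero (suc v) (fromZero j) (fromZero-adj j)))
        (xorSum-delta v (λ j → adj G zero (suc j)))
  where
  fromZero-adj : ∀ j → adj (edgeOf (fromZero j)) zero (suc v) ≡ ⌊ v ≟ j ⌋
  fromZero-adj j = trans (∨-identityʳ ⌊ suc v ≟ suc j ⌋) (≟-suc v j)

shiftPair-adj-zero : ∀ {n} (P : Pair n) v → adj (edgeOf (shiftPair P)) zero v ≡ false
shiftPair-adj-zero (pair _ _ _) v = refl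

shiftPair-adj : ∀ {n} (P : Pair n) a c → adj (edgeOf (shiftPair P)) (suc a) (suc c) ≡ adj (edgeOf P) a c
shiftPair-adj (pair i i' _) a c =
  cong₂ _∨_ (cong₂ _∧_ (≟-suc a i) (≟-suc c i')) (cong₂ _∧_ (≟-suc a i') (≟-suc c i))

dropZero : ∀ {n} → Graph (Fin (suc n)) → Graph (Fin n)
adj    (dropZero G) u v = adj G (suc u) (suc v)
sym    (dropZero G) u v = sym G (suc u) (suc v)
irrefl (dropZero G) v   = irrefl G (suc v)

xorSum-pairs-suc : ∀ {n} (f : Pair (suc n) → Bool) →
  xorSum (pairs (suc n)) f ≡ xorSum (allFin n) (f ∘ fromZero) xor xorSum (pairs n) (f ∘ shiftPair)
xorSum-pairs-suc {n} f = begin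
  xorSum (List.map fromZero (allFin n) ++ List.map shiftPair (pairs n)) f
    ≡⟨ xorSum-++ (List.map fromZero (allFin n)) (List.map shiftPair (pairs n)) f ⟩
  xorSum (List.map fromZero (allFin n)) f xor xorSum (List.map shiftPair (pairs n)) f
    ≡⟨ cong₂ _xor_ (xorSum-map fromZero (allFin n) f) (xorSum-map shiftPair (pairs n) f) ⟩
  xorSum (allFin n) (f ∘ fromZero) xor xorSum (pairs n) (f ∘ shiftPair) ∎

edge-decomposition-zero : ∀ {n} (G : Graph (Fin (suc n))) v →
  xorSum (pairs (suc n)) (edgeTerm G zero (suc v)) ≡ adj G zero (suc v)
edge-decomposition-zero {n} G v = begin
  xorSum (pairs (suc n)) term
    ≡⟨ xorSum-pairs-suc term ⟩
  xorSum (allFin n) (term ∘ fromZero) xor xorSum (pairs n) (term ∘ shiftPair)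
    ≡⟨ cong₂ _xor_ (fromZero-sum G v) (xorSum-zero (pairs n) shifted) ⟩
  adj G zero (suc v) xor false
    ≡⟨ xor-identityʳ (adj G zero (suc v)) ⟩
  adj G zero (suc v) ∎
  where
  term : Pair (suc n) → Bool
  term = edgeTerm G zero (suc v)

  shifted : ∀ P → term (shiftPair P) ≡ false
  shifted P = edgeTerm-cong G zero (suc v) (shiftPair P) (shiftPair-adj-zero P (suc v))

-- Induction on n: the pairs through 0 give the edges at 0, the shifted pairs those of dropZero G.
edge-decomposition : ∀ {n} (G : Graph (Fin n)) a c → xorSum (pairs n) (edgeTerm G a c) ≡ adj G a c
edge-decomposition {suc n} G zero zero = begin
  xorSum (pairs (suc n)) term
    ≡⟨ xorSum-pairs-suc term ⟩
  xorSum (allFin n) (term ∘ fromZero) xor xorSum (pairs n) (term ∘ shiftPair)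
    ≡⟨ cong₂ _xor_ (xorSum-zero (allFin n) (λ _ → refl)) (xorSum-zero (pairs n) shifted) ⟩
  false
    ≡⟨ ≡-sym (irrefl G zero) ⟩
  adj G zero zero ∎
  where
  term : Pair (suc n) → Bool
  term = edgeTerm G zero zero

  shifted : ∀ P → term (shiftPair P) ≡ false
  shifted P = edgeTerm-cong G zero zero (shiftPair P) (shiftPair-adj-zero P zero)
edge-decomposition {suc n} G zero (suc c) = edge-decomposition-zero G c
edge-decomposition {suc n} G (suc a) zero = begin
  xorSum (pairs (suc n)) (edgeTerm G (suc a) zero)
    ≡⟨ xorSum-cong (pairs (suc n)) (λ P → edgeTerm-cong G (suc a) zero P (sym (edgeOf P) (suc a) zero))
     ⟩
  xorSum (pairs (suc n)) (edgeTerm G zero (suc a))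
    ≡⟨ edge-decomposition-zero G a ⟩
  adj G zero (suc a)
    ≡⟨ sym G zero (suc a) ⟩
  adj G (suc a) zero ∎
edge-decomposition {suc n} G (suc a) (suc c) = begin
  xorSum (pairs (suc n)) term
    ≡⟨ xorSum-pairs-suc term ⟩
  xorSum (allFin n) (term ∘ fromZero) xor xorSum (pairs n) (term ∘ shiftPair)
    ≡⟨ cong₂ _xor_ (xorSum-zero (allFin n) through-zero) (xorSum-cong (pairs n) shifted) ⟩
  false xor xorSum (pairs n) (edgeTerm (dropZero G) a c)
    ≡⟨ edge-decomposition (dropZero G) a c ⟩
  adj G (suc a) (suc c) ∎
  where
  term : Pair (suc n) → Bool
  term = edgeTerm G (suc a) (suc c)

  through-zero : ∀ j → term (fromZero j) ≡ false
  through-zero j = edgeTerm-cong G (suc a) (suc c) (fromZero j) (∧-zeroʳ ⌊ suc a ≟ suc j ⌋)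

  shifted : ∀ P → term (shiftPair P) ≡ edgeTerm (dropZero G) a c P
  shifted P = edgeTerm-cong G (suc a) (suc c) (shiftPair P) (shiftPair-adj P a c)

record TensorShaped {A B : Set} (K : Graph (A × B)) : Set where
  field
    rowFree    : ∀ i j j' → adj K (i , j) (i , j') ≡ false
    columnFree : ∀ i i' j → adj K (i , j) (i' , j) ≡ false
    crossSym   : ∀ i j i' j' → adj K (i , j) (i' , j') ≡ adj K (i , j') (i' , j)
open TensorShaped

module _ {A B : Set} where

  tensorShaped-resp : {K L : Graph (A × B)} → K ≈G L → TensorShaped L → TensorShaped K
  tensorShaped-resp K≈L L-shaped = record
    { rowFree    = λ i j j' → trans (K≈L _ _) (rowFree L-shaped i j j')
    ; columnFree = λ i i' j → trans (K≈L _ _) (columnFree L-shaped i i' j)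
    ; crossSym   = λ i j i' j' →
        trans (K≈L _ _) (trans (crossSym L-shaped i j i' j') (≡-sym (K≈L _ _)))
    }

  tensorShaped-⊗ : (G : Graph A) (H : Graph B) → TensorShaped (G ⊗ H)
  tensorShaped-⊗ G H = record
    { rowFree    = λ i j j' → cong (_∧ adj H j j') (irrefl G i)
    ; columnFree = λ i i' j → trans (cong (adj G i i' ∧_) (irrefl H j)) (∧-zeroʳ (adj G i i'))
    ; crossSym   = λ i j i' j' → cong (adj G i i' ∧_) (sym H j j')
    }

  tensorShaped-empty : TensorShaped {A} {B} emptyG
  tensorShaped-empty = record
    { rowFree = λ _ _ _ → refl ; columnFree = λ _ _ _ → refl ; crossSym = λ _ _ _ _ → refl }

  tensorShaped-⊕ : {K L : Graph (A × B)} → TensorShaped K → TensorShaped L → TensorShaped (K ⊕ L)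
  tensorShaped-⊕ K-shaped L-shaped = record
    { rowFree    = λ i j j' → cong₂ _xor_ (rowFree K-shaped i j j') (rowFree L-shaped i j j')
    ; columnFree = λ i i' j → cong₂ _xor_ (columnFree K-shaped i i' j) (columnFree L-shaped i i' j)
    ; crossSym   = λ i j i' j' → cong₂ _xor_ (crossSym K-shaped i j i' j') (crossSym L-shaped i j i' j')
    }

  tensorShaped-⨁ : ∀ {X : Set} (h : X → Graph (A × B)) → (∀ x → TensorShaped (h x)) →
    ∀ xs → TensorShaped (List.foldr _⊕_ emptyG (List.map h xs))
  tensorShaped-⨁ h shaped []       = tensorShaped-empty
  tensorShaped-⨁ h shaped (x ∷ xs) = tensorShaped-⊕ (shaped x) (tensorShaped-⨁ h shaped xs)

subgraph-nonedge : ∀ {V} {K L : Graph V} → SpanningSubgraphOf K L →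
  ∀ u v → adj L u v ≡ false → adj K u v ≡ false
subgraph-nonedge K⊆L u v nonedge = ¬-not (λ edge → not-¬ nonedge (K⊆L u v edge))

module _ {p q : ℕ} {K : Graph (Fin p × Fin q)} where

  tensorShaped⇒spanning : TensorShaped K → SpanningSubgraphOf K (completeG p ⊗ completeG q)
  tensorShaped⇒spanning shaped (a , b) (c , d) edge with a ≟ c | b ≟ d
  ... | yes refl | _       = ⊥-elim (not-¬ (rowFree shaped a b d) edge)
  ... | no _     | yes refl = ⊥-elim (not-¬ (columnFree shaped a c b) edge)
  ... | no _     | no _     = refl

  tensorShaped⇒crossLike : TensorShaped K → CrossLike K
  tensorShaped⇒crossLike shaped i j i' j' edge = trans (≡-sym (crossSym shaped i j i' j')) edge

  -- K_p ⊗ K_q is tensor-shaped, so its spanning subgraphs have no row or column edges;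
  -- cross-likeness applied in both directions gives cross-symmetry.
  spanning-crossLike⇒tensorShaped :
    SpanningSubgraphOf K (completeG p ⊗ completeG q) → CrossLike K → TensorShaped K
  spanning-crossLike⇒tensorShaped K⊆K⊗K cross = record
    { rowFree    = λ i j j' → nonedge _ _ (rowFree complete-shaped i j j')
    ; columnFree = λ i i' j → nonedge _ _ (columnFree complete-shaped i i' j)
    ; crossSym   = λ i j i' j' → ⇔→≡ (mk⇔ (cross i j i' j') (cross i j' i' j))
    }
    where
    complete-shaped : TensorShaped (completeG p ⊗ completeG q)
    complete-shaped = tensorShaped-⊗ (completeG p) (completeG q)

    nonedge : ∀ u v → adj (completeG p ⊗ completeG q) u v ≡ false → adj K u v ≡ false
    nonedge = subgraph-nonedge {K = K} {L = completeG p ⊗ completeG q} K⊆K⊗K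

elementary : ∀ {p q} → Pair p → Pair q → ElemIndex p q
elementary P Q = record
  { i = lo P ; i' = hi P ; j = lo Q ; j' = hi Q ; i≢i' = lo≢hi P ; j≢j' = lo≢hi Q }

component : ∀ {p q} → Graph (Fin p × Fin q) → Pair p → Pair q → List (ElemIndex p q)
component K P Q = if adj K (lo P , lo Q) (hi P , hi Q) then [ elementary P Q ] else []

components : ∀ {p q} → Graph (Fin p × Fin q) → List (ElemIndex p q)
components {p} {q} K = concatMap (λ P → concatMap (component K P) (pairs q)) (pairs p)

module _ {p q : ℕ} {K : Graph (Fin p × Fin q)} (shaped : TensorShaped K) where

  rowSlice : Fin p → Fin p → Graph (Fin q)
  adj    (rowSlice i i') j j' = adj K (i , j) (i' , j')
  sym    (rowSlice i i') j j' = crossSym shaped i j i' j'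
  irrefl (rowSlice i i') j    = columnFree shaped i i' j

  columnSlice : Fin q → Fin q → Graph (Fin p)
  adj    (columnSlice j j') i i' = adj K (i , j) (i' , j')
  sym    (columnSlice j j') i i' = trans (crossSym shaped i j i' j') (sym K (i , j') (i' , j))
  irrefl (columnSlice j j') i    = rowFree shaped i j j'

  components-sum : ∀ u v → xorSum (components K) (λ e → adj (E e) u v) ≡ adj K u v
  components-sum (a , b) (c , d) = begin
    xorSum (components K) edgeAt
      ≡⟨ xorSum-concatMap _ (pairs p) edgeAt ⟩
    xorSum (pairs p) (λ P → xorSum (concatMap (component K P) (pairs q)) edgeAt)
      ≡⟨ xorSum-cong (pairs p) rows ⟩
    xorSum (pairs p) (λ P → adj (edgeOf P) a c ∧ adj (columnSlice b d) (lo P) (hi P))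
      ≡⟨ edge-decomposition (columnSlice b d) a c ⟩
    adj K (a , b) (c , d) ∎
    where
    edgeAt : ElemIndex p q → Bool
    edgeAt e = adj (E e) (a , b) (c , d)

    ∧-rotate : ∀ x y z → x ∧ (y ∧ z) ≡ y ∧ (z ∧ x)
    ∧-rotate x y z = trans (∧-comm x (y ∧ z)) (∧-assoc y z x)

    rows : ∀ P → xorSum (concatMap (component K P) (pairs q)) edgeAt
                 ≡ adj (edgeOf P) a c ∧ adj K (lo P , b) (hi P , d)
    rows P = begin
      xorSum (concatMap (component K P) (pairs q)) edgeAt
        ≡⟨ xorSum-concatMap (component K P) (pairs q) edgeAt ⟩
      xorSum (pairs q) (λ Q → xorSum (component K P Q) edgeAt)
        ≡⟨ xorSum-cong (pairs q) summand ⟩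
      xorSum (pairs q) (λ Q → ac ∧ edgeTerm slice b d Q)
        ≡⟨ ≡-sym (∧-distrib-xorSum ac (pairs q) (edgeTerm slice b d)) ⟩
      ac ∧ xorSum (pairs q) (edgeTerm slice b d)
        ≡⟨ cong (ac ∧_) (edge-decomposition slice b d) ⟩
      ac ∧ adj K (lo P , b) (hi P , d) ∎
      where
      ac : Bool
      ac = adj (edgeOf P) a c

      slice : Graph (Fin q)
      slice = rowSlice (lo P) (hi P)

      summand : ∀ Q → xorSum (component K P Q) edgeAt ≡ ac ∧ edgeTerm slice b d Q
      summand Q = let k = adj K (lo P , lo Q) (hi P , hi Q) in
        trans (xorSum-if k (elementary P Q) edgeAt) (∧-rotate k ac (adj (edgeOf Q) b d))

foldr-⊕-adj : ∀ {X V : Set} (h : X → Graph V) (xs : List X) u v →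
  adj (List.foldr _⊕_ emptyG (List.map h xs)) u v ≡ xorSum xs (λ x → adj (h x) u v)
foldr-⊕-adj h []       u v = refl
foldr-⊕-adj h (x ∷ xs) u v = cong (adj (h x) u v xor_) (foldr-⊕-adj h xs u v)

someElementary : ∀ {p q} → p ≥ 2 → q ≥ 2 → ElemIndex p q
someElementary (s≤s (s≤s _)) (s≤s (s≤s _)) = elementary pair₀₁ pair₀₁ where
  pair₀₁ : ∀ {n} → Pair (suc (suc n))
  pair₀₁ = pair zero (suc zero) (λ ())

-- (ii) ⇒ (iii): K is the 2-sum of its components, padded by E ⊕ E so the sum is nonempty.
tensorShaped⇒sumOfElementary : ∀ {p q} {K : Graph (Fin p × Fin q)} → p ≥ 2 → q ≥ 2 →
  TensorShaped K → SumOfElementary p q K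
tensorShaped⇒sumOfElementary {p} {q} {K} p≥2 q≥2 shaped = (e ∷ e ∷ components K) , decomposition
  where
  e : ElemIndex p q
  e = someElementary p≥2 q≥2

  rest : Graph (Fin p × Fin q)
  rest = List.foldr _⊕_ emptyG (List.map E (components K))

  decomposition : K ≈G ⨁ (List⁺.map E (e ∷ e ∷ components K))
  decomposition u v = ≡-sym (begin
    adj (E e) u v xor (adj (E e) u v xor adj rest u v)
      ≡⟨ ≡-sym (xor-assoc (adj (E e) u v) (adj (E e) u v) (adj rest u v)) ⟩
    (adj (E e) u v xor adj (E e) u v) xor adj rest u v
      ≡⟨ cong (_xor adj rest u v) (xor-same (adj (E e) u v)) ⟩
    adj rest u v
      ≡⟨ foldr-⊕-adj E (components K) u v ⟩
    xorSum (components K) (λ x → adj (E x) u v)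
      ≡⟨ components-sum shaped u v ⟩
    adj K u v ∎)

edgeG-nontrivial : ∀ {n} (a b : Fin n) (a≢b : a ≢ b) → Nontrivial (edgeG a b a≢b)
edgeG-nontrivial a b a≢b =
  a , b , cong₂ (λ x y → (x ∧ y) ∨ (⌊ a ≟ b ⌋ ∧ ⌊ b ≟ a ⌋)) (≟-refl a) (≟-refl b)

elementaryTerm : ∀ {p q} → ElemIndex p q → TensorTerm p q
elementaryTerm e = record
  { G = edgeG i i' i≢i' ; H = edgeG j j' j≢j'
  ; G-nontrivial = edgeG-nontrivial i i' i≢i' ; H-nontrivial = edgeG-nontrivial j j' j≢j' }
  where open ElemIndex e

sumOfElementary⇒inK : ∀ {p q} {K : Graph (Fin p × Fin q)} → SumOfElementary p q K → InK p q K
sumOfElementary⇒inK ((e ∷ es) , K≈ΣE) = (elementaryTerm e ∷ List.map elementaryTerm es) , λ u v →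
  trans (K≈ΣE u v) (cong (λ gs → adj (List.foldr _⊕_ emptyG (E e ∷ gs)) u v) (map-∘ es))

inK⇒tensorShaped : ∀ {p q} {K : Graph (Fin p × Fin q)} → InK p q K → TensorShaped K
inK⇒tensorShaped ((t ∷ ts) , K≈ΣGH) =
  tensorShaped-resp K≈ΣGH
    (tensorShaped-⨁ termGraph (λ t → tensorShaped-⊗ (TensorTerm.G t) (TensorTerm.H t)) (t ∷ ts))

theorem1 : (p q : ℕ) → p ≥ 2 → q ≥ 2 → (K : Graph (Fin p × Fin q)) →
    ((InK p q K ⇔ (SpanningSubgraphOf K (completeG p ⊗ completeG q) × CrossLike K))
     × ((SpanningSubgraphOf K (completeG p ⊗ completeG q) × CrossLike K) ⇔ SumOfElementary p q K))
theorem1 p q p≥2 q≥2 K = mk⇔ i⇒ii (iii⇒i ∘ ii⇒iii) , mk⇔ ii⇒iii (i⇒ii ∘ iii⇒i)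
  where
  shaped⇒ii : TensorShaped K → SpanningSubgraphOf K (completeG p ⊗ completeG q) × CrossLike K
  shaped⇒ii shaped = tensorShaped⇒spanning shaped , tensorShaped⇒crossLike shaped

  i⇒ii : InK p q K → SpanningSubgraphOf K (completeG p ⊗ completeG q) × CrossLike K
  i⇒ii = shaped⇒ii ∘ inK⇒tensorShaped {K = K}

  ii⇒iii : SpanningSubgraphOf K (completeG p ⊗ completeG q) × CrossLike K → SumOfElementary p q K
  ii⇒iii (spanning , cross) =
    tensorShaped⇒sumOfElementary p≥2 q≥2 (spanning-crossLike⇒tensorShaped {K = K} spanning cross)

  iii⇒i : SumOfElementary p q K → InK p q K
  iii⇒i = sumOfElementary⇒inK {K = K}
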